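{- Let $\lambda=(a,b)$ be a two-row shape ($a\ge b\ge1$), let $T$ be a standard Young tableau of shape $\lambda$, and let $P=(v_0,\dots,v_{a+b})$ be the associated Dyck path. Then an entry $i$ of $T$ has $\operatorname{dep}(i)=1$ if and only if $P$ has a return to ground at $v_i$.
   Context: A standard Young tableau of shape $(a,b)$ is a filling of two left-justified rows of lengths $a$ (top) and $b$ (bottom) by $1,\dots,a+b$ increasing along rows and down columns. The associated Dyck path is $v_0=(0,0)$, $v_i=v_{i-1}+(1,0)$ if $i$ is in the first row and $v_i=v_{i-1}+(0,1)$ if $i$ is in the second row; it stays in $\{y\le x\}$ and ends at $(a,b)$. $P$ has a return to ground at $v_i$ if $v_i=(x,x)$ for some positive integer $x$. For an entry $k$ in column $j$, $\operatorname{dep}(k)$ is the number of entries of column $j$ smaller than $k$ minus the number of entries of column $j+1$ smaller than $k$ (the latter $0$ if there is no column $j+1$). -}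

module Defs where

open import Data.Nat using (ℕ; zero; suc; _+_; _≤_; _<_; _≟_; _<?_)
open import Data.Fin using (Fin; toℕ; fromℕ<)
open import Data.Fin.Properties using (any?)
open import Data.Integer using (ℤ; +_; _-_)
open import Data.List using (List; []; _∷_; [_]; _++_; length; filter)
open import Data.Product using (_×_; _,_; ∃)
open import Data.Sum using (_⊎_)
open import Data.Bool using (if_then_else_)
open import Relation.Nullary using (¬_; does; yes; no)
open import Relation.Binary.PropositionalEquality using (_≡_)

record SYT (a b : ℕ) : Set where
  field
    top : Fin a → ℕ
    bot : Fin b → ℕ
    top-inc : ∀ (i j : Fin a) → toℕ i < toℕ j → top i < top j
    bot-inc : ∀ (i j : Fin b) → toℕ i < toℕ j → bot i < bot j
    col-inc : ∀ (j : Fin b) (k : Fin a) → toℕ j ≡ toℕ k → top k < bot j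
    top-range : ∀ (i : Fin a) → 1 ≤ top i × top i ≤ a + b
    bot-range : ∀ (j : Fin b) → 1 ≤ bot j × bot j ≤ a + b
    disjoint : ∀ (i : Fin a) (j : Fin b) → ¬ (top i ≡ bot j)
    onto : ∀ (k : ℕ) → 1 ≤ k → k ≤ a + b →
           ∃ (λ (i : Fin a) → top i ≡ k) ⊎ ∃ (λ (j : Fin b) → bot j ≡ k)

open SYT public

module _ {a b : ℕ} (T : SYT a b) where

  inTop? : (k : ℕ) → _
  inTop? k = any? (λ (i : Fin a) → top T i ≟ k)

  path : ℕ → ℕ × ℕ
  path zero = 0 , 0
  path (suc i) with path i
  ... | x , y = if does (inTop? (suc i)) then (suc x , y) else (x , suc y)

  ReturnAt : ℕ → Set
  ReturnAt i = ∃ λ (x : ℕ) → 1 ≤ x × path i ≡ (x , x)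

  column : ℕ → List ℕ
  column c = topPart ++ botPart
    where
    topPart : List ℕ
    topPart with c <? a
    ... | yes p = [ top T (fromℕ< p) ]
    ... | no _ = []
    botPart : List ℕ
    botPart with c <? b
    ... | yes p = [ bot T (fromℕ< p) ]
    ... | no _ = []

  countLess : ℕ → List ℕ → ℕ
  countLess k L = length (filter (_<? k) L)

  dep : (c k : ℕ) → ℤ
  dep c k = + countLess k (column c) - + countLess k (column (suc c))

-- Along the path, v_i = (x , y) where x and y count the entries ≤ i of the two rows.
-- The top entry of column c is preceded by more than c top entries and at most c bottom
-- ones, so v_i is off the diagonal, and nothing in columns c, c + 1 lies below it, so its
-- dep is 0. For the bottom entry i of column c exactly c + 1 bottom entries are ≤ i and
-- column c contributes 1 to dep(i); both "dep(i) = 1" and "v_i is on the diagonal" then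
-- say that the top entry of column c + 1, if any, exceeds i.
module Submission where

open import Defs
open import Data.Nat using (ℕ; zero; suc; _+_; _≤_; _<_; z≤n; s≤s; s≤s⁻¹)
open import Data.Nat.Properties
open import Data.Integer using (+_; _-_)
open import Data.Fin using (Fin; toℕ; fromℕ<)
open import Data.Fin.Properties using (toℕ<n; toℕ-fromℕ<; toℕ-injective)
open import Data.List using (_∷_; length)
open import Data.List.Properties using (filter-accept; filter-reject; filter-none)
open import Data.List.Membership.Propositional using (_∈_)
open import Data.List.Membership.Propositional.Properties using (∈-filter⁺; ∈-length)
open import Data.List.Relation.Unary.All using (tabulate)
open import Data.List.Relation.Unary.Any using (here; there)
open import Data.Product using (_×_; _,_; ∃; proj₁; proj₂)
open import Data.Sum using (_⊎_; inj₁; inj₂)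
open import Function.Bundles using (_⇔_; mk⇔)
open import Function.Construct.Composition using (_⇔-∘_)
open import Function.Construct.Symmetry using (⇔-sym)
open import Relation.Nullary using (¬_; yes; no; contradiction)
open import Relation.Binary.PropositionalEquality
  using (_≡_; _≢_; refl; sym; trans; cong; cong₂; subst; subst₂)

Increasing : {n : ℕ} → (Fin n → ℕ) → Set
Increasing f = ∀ i j → toℕ i < toℕ j → f i < f j

increasing⇒monotone : {n : ℕ} {f : Fin n → ℕ} → Increasing f →
  ∀ {i j} → toℕ i ≤ toℕ j → f i ≤ f j
increasing⇒monotone inc {i} {j} i≤j with m≤n⇒m<n∨m≡n i≤j
... | inj₁ i<j = <⇒≤ (inc i j i<j)
... | inj₂ i≡j = ≤-reflexive (cong _ (toℕ-injective i≡j))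

-- For increasing f, x is the number of entries ≤ m: they are f 0 , … , f (x - 1).
record Rank {n : ℕ} (f : Fin n → ℕ) (m x : ℕ) : Set where
  field
    bounded : x ≤ n
    below   : ∀ j → toℕ j < x → f j ≤ m
    above   : ∀ j → x ≤ toℕ j → m < f j

open Rank

module _ {n : ℕ} {f : Fin n → ℕ} {m x : ℕ} where

  toℕ<rank : Rank f m x → ∀ j → f j ≤ m → toℕ j < x
  toℕ<rank r j fj≤m = ≰⇒> λ x≤j → <⇒≱ (above r j x≤j) fj≤m

  rank≤toℕ : Rank f m x → ∀ j → m < f j → x ≤ toℕ j
  rank≤toℕ r j m<fj = ≮⇒≥ λ j<x → <⇒≱ m<fj (below r j j<x)

  <rank : Rank f m x → ∀ {k} (k<n : k < n) → f (fromℕ< k<n) ≤ m → k < x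
  <rank r k<n le = subst (_< x) (toℕ-fromℕ< k<n) (toℕ<rank r _ le)

  rank≤ : Rank f m x → ∀ {k} (k<n : k < n) → m < f (fromℕ< k<n) → x ≤ k
  rank≤ r k<n lt = subst (x ≤_) (toℕ-fromℕ< k<n) (rank≤toℕ r _ lt)

  rank-suc-hit : Increasing f → Rank f m x → ∀ j → f j ≡ suc m → Rank f (suc m) (suc x)
  rank-suc-hit inc r j fj≡1+m = record
    { bounded = subst (_< n) j≡x (toℕ<n j)
    ; below   = λ i i<1+x → subst (f i ≤_) fj≡1+m
                  (increasing⇒monotone inc (≤-trans (s≤s⁻¹ i<1+x) (≤-reflexive (sym j≡x))))
    ; above   = λ i 1+x≤i → subst (_< f i) fj≡1+m
                  (inc j i (subst (_< toℕ i) (sym j≡x) 1+x≤i))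
    }
    where
    x≤j : x ≤ toℕ j
    x≤j = rank≤toℕ r j (subst (m <_) (sym fj≡1+m) (n<1+n m))

    -- Otherwise the entry at index x would lie strictly between m and f j = m + 1.
    j≤x : toℕ j ≤ x
    j≤x = ≮⇒≥ λ x<j →
      let e    = fromℕ< (<-trans x<j (toℕ<n j))
          e≡x  = toℕ-fromℕ< (<-trans x<j (toℕ<n j))
          fe<fj = inc e j (subst (_< toℕ j) (sym e≡x) x<j)
      in <⇒≱ (above r e (≤-reflexive (sym e≡x))) (s≤s⁻¹ (subst (f e <_) fj≡1+m fe<fj))

    j≡x : toℕ j ≡ x
    j≡x = ≤-antisym j≤x x≤j

  rank-suc-miss : Rank f m x → (∀ j → f j ≢ suc m) → Rank f (suc m) x
  rank-suc-miss r miss = record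
    { bounded = bounded r
    ; below   = λ j j<x → m≤n⇒m≤1+n (below r j j<x)
    ; above   = λ j x≤j → ≤∧≢⇒< (above r j x≤j) (λ 1+m≡fj → miss j (sym 1+m≡fj))
    }

rank-zero : {n : ℕ} {f : Fin n → ℕ} → (∀ j → 1 ≤ f j) → Rank f 0 0
rank-zero positive = record { bounded = z≤n ; below = λ _ () ; above = λ j _ → positive j }

1-n≡1⇔n≡0 : ∀ n → (+ 1 - + n ≡ + 1) ⇔ (n ≡ 0)
1-n≡1⇔n≡0 zero          = mk⇔ (λ _ → refl) (λ _ → refl)
1-n≡1⇔n≡0 (suc zero)    = mk⇔ (λ ()) (λ ())
1-n≡1⇔n≡0 (suc (suc n)) = mk⇔ (λ ()) (λ ())

module _ {a b : ℕ} (T : SYT a b) where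

  PathRanks : ℕ → Set
  PathRanks i = Rank (top T) i (proj₁ (path T i)) × Rank (bot T) i (proj₂ (path T i))

  path-ranks : ∀ i → i ≤ a + b → PathRanks i
  path-ranks zero _ = rank-zero (λ j → proj₁ (top-range T j)) , rank-zero (λ j → proj₁ (bot-range T j))
  path-ranks (suc i) 1+i≤a+b with path T i | path-ranks i (≤-trans (n≤1+n i) 1+i≤a+b)
  ... | _ | rx , ry with inTop? T (suc i)
  ... | yes (j , topj≡1+i) =
    rank-suc-hit (top-inc T) rx j topj≡1+i ,
    rank-suc-miss ry (λ j' botj'≡1+i → disjoint T j j' (trans topj≡1+i (sym botj'≡1+i)))
  ... | no notTop with onto T (suc i) (s≤s z≤n) 1+i≤a+b
  ...   | inj₁ inTop       = contradiction inTop notTop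
  ...   | inj₂ (j , botj≡1+i) =
    rank-suc-miss rx (λ j' topj'≡1+i → notTop (j' , topj'≡1+i)) ,
    rank-suc-hit (bot-inc T) ry j botj≡1+i

  countLess≡0 : ∀ k L → (∀ {x} → x ∈ L → k ≤ x) → countLess T k L ≡ 0
  countLess≡0 k L k≤L = cong length (filter-none (_<? k) (tabulate (λ x∈L → ≤⇒≯ (k≤L x∈L))))

  countLess>0 : ∀ {k x L} → x ∈ L → x < k → 0 < countLess T k L
  countLess>0 x∈L x<k = ∈-length (∈-filter⁺ (_<? _) x∈L x<k)

  topAt : ∀ {c} → c < a → ℕ
  topAt c<a = top T (fromℕ< c<a)

  botAt : ∀ {c} → c < b → ℕ
  botAt c<b = bot T (fromℕ< c<b)

  topAt-mono : ∀ {j k} (j<a : j < a) (k<a : k < a) → j ≤ k → topAt j<a ≤ topAt k<a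
  topAt-mono j<a k<a j≤k = increasing⇒monotone (top-inc T)
    (subst₂ _≤_ (sym (toℕ-fromℕ< j<a)) (sym (toℕ-fromℕ< k<a)) j≤k)

  botAt-strict : ∀ {j k} (j<b : j < b) (k<b : k < b) → j < k → botAt j<b < botAt k<b
  botAt-strict j<b k<b j<k = bot-inc T _ _
    (subst₂ _<_ (sym (toℕ-fromℕ< j<b)) (sym (toℕ-fromℕ< k<b)) j<k)

  module _ (b≤a : b ≤ a) where

    topAt<botAt : ∀ {j k} (k<a : k < a) (j<b : j < b) → k ≤ j → topAt k<a < botAt j<b
    topAt<botAt k<a j<b k≤j = ≤-<-trans (topAt-mono k<a j<a k≤j)
      (col-inc T (fromℕ< j<b) (fromℕ< j<a) (trans (toℕ-fromℕ< j<b) (sym (toℕ-fromℕ< j<a))))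
      where
      j<a : _ < a
      j<a = <-≤-trans j<b b≤a

    ∈-column⁻ : ∀ {x} c → x ∈ column T c →
      (∃ λ (c<a : c < a) → x ≡ topAt c<a) ⊎ (∃ λ (c<b : c < b) → x ≡ botAt c<b)
    ∈-column⁻ c x∈col with c <? a | c <? b | x∈col
    ... | yes c<a | _       | here x≡top         = inj₁ (c<a , x≡top)
    ... | yes _   | yes c<b | there (here x≡bot) = inj₂ (c<b , x≡bot)
    ... | no c≮a  | yes c<b | _                  = contradiction (<-≤-trans c<b b≤a) c≮a
    ... | yes _   | no _    | there ()
    ... | yes _   | yes _   | there (there ())
    ... | no _    | no _    | ()

    topAt∈column : ∀ c (c<a : c < a) → topAt c<a ∈ column T c
    topAt∈column c c<a with c <? a
    ... | yes _  = here refl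
    ... | no c≮a = contradiction c<a c≮a

    topAt≤column : ∀ {c c' x} (c<a : c < a) → c ≤ c' → x ∈ column T c' → topAt c<a ≤ x
    topAt≤column c<a c≤c' x∈col with ∈-column⁻ _ x∈col
    ... | inj₁ (c'<a , refl) = topAt-mono c<a c'<a c≤c'
    ... | inj₂ (c'<b , refl) = <⇒≤ (topAt<botAt c<a c'<b c≤c')

    diagonal : ∀ {i} → ReturnAt T i → proj₁ (path T i) ≡ proj₂ (path T i)
    diagonal (_ , _ , vᵢ≡xx) = trans (cong proj₁ vᵢ≡xx) (sym (cong proj₂ vᵢ≡xx))

    dep-topAt : ∀ c (c<a : c < a) → dep T c (topAt c<a) ≡ + 0
    dep-topAt c c<a = cong₂ (λ m n → + m - + n)
      (countLess≡0 _ _ (topAt≤column c<a ≤-refl))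
      (countLess≡0 _ _ (topAt≤column c<a (n≤1+n c)))

    ¬ReturnAt-topAt : ∀ c (c<a : c < a) → ¬ ReturnAt T (topAt c<a)
    ¬ReturnAt-topAt c c<a ret = <⇒≱ c<x (subst (_≤ c) (sym (diagonal {topAt c<a} ret)) y≤c)
      where
      ranks : PathRanks (topAt c<a)
      ranks = path-ranks (topAt c<a) (proj₂ (top-range T (fromℕ< c<a)))

      c<x : c < proj₁ (path T (topAt c<a))
      c<x = <rank (proj₁ ranks) c<a ≤-refl

      y≤c : proj₂ (path T (topAt c<a)) ≤ c
      y≤c with c <? b
      ... | yes c<b = rank≤ (proj₂ ranks) c<b (topAt<botAt c<a c<b ≤-refl)
      ... | no c≮b  = ≤-trans (bounded (proj₂ ranks)) (≮⇒≥ c≮b)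

    NextTopBelow : ∀ {c} → c < b → Set
    NextTopBelow {c} c<b = ∃ λ (1+c<a : suc c < a) → topAt 1+c<a < botAt c<b

    module _ {c : ℕ} (c<b : c < b) where

      c<a : c < a
      c<a = <-≤-trans c<b b≤a

      botAt-ranks : PathRanks (botAt c<b)
      botAt-ranks = path-ranks (botAt c<b) (proj₂ (bot-range T (fromℕ< c<b)))

      1+c≤x : suc c ≤ proj₁ (path T (botAt c<b))
      1+c≤x = <rank (proj₁ botAt-ranks) c<a (<⇒≤ (topAt<botAt c<a c<b ≤-refl))

      y≡1+c : proj₂ (path T (botAt c<b)) ≡ suc c
      y≡1+c = ≤-antisym y≤1+c (<rank (proj₂ botAt-ranks) c<b ≤-refl)
        where
        y≤1+c : proj₂ (path T (botAt c<b)) ≤ suc c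
        y≤1+c with suc c <? b
        ... | yes 1+c<b = rank≤ (proj₂ botAt-ranks) 1+c<b (botAt-strict c<b 1+c<b (n<1+n c))
        ... | no 1+c≮b  = ≤-trans (bounded (proj₂ botAt-ranks)) (≮⇒≥ 1+c≮b)

      countLess-botAt-column : countLess T (botAt c<b) (column T c) ≡ 1
      countLess-botAt-column with c <? a | c <? b
      ... | yes _  | yes _   = cong length (trans
              (filter-accept (_<? botAt c<b) (topAt<botAt c<a c<b ≤-refl))
              (cong (_ ∷_) (filter-reject (_<? botAt c<b) (<-irrefl refl))))
      ... | no c≮a | _       = contradiction c<a c≮a
      ... | yes _  | no c≮b  = contradiction c<b c≮b

      dep-botAt≡1⇔ : (dep T c (botAt c<b) ≡ + 1) ⇔ (countLess T (botAt c<b) (column T (suc c)) ≡ 0)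
      dep-botAt≡1⇔ rewrite countLess-botAt-column = 1-n≡1⇔n≡0 _

      countLess-next≡0⇔ : (countLess T (botAt c<b) (column T (suc c)) ≡ 0) ⇔ (¬ NextTopBelow c<b)
      countLess-next≡0⇔ = mk⇔
        (λ count≡0 (1+c<a , top<k) →
          <⇒≢ (countLess>0 (topAt∈column (suc c) 1+c<a) top<k) (sym count≡0))
        (λ ¬below → countLess≡0 _ _ (λ x∈col → k≤next ¬below (∈-column⁻ (suc c) x∈col)))
        where
        k≤next : ∀ {x} → ¬ NextTopBelow c<b →
          (∃ λ (1+c<a : suc c < a) → x ≡ topAt 1+c<a) ⊎ (∃ λ (1+c<b : suc c < b) → x ≡ botAt 1+c<b) →
          botAt c<b ≤ x
        k≤next ¬below (inj₁ (1+c<a , refl)) = ≮⇒≥ λ top<k → ¬below (1+c<a , top<k)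
        k≤next ¬below (inj₂ (1+c<b , refl)) = <⇒≤ (botAt-strict c<b 1+c<b (n<1+n c))

      ReturnAt-botAt⇔ : ReturnAt T (botAt c<b) ⇔ (¬ NextTopBelow c<b)
      ReturnAt-botAt⇔ = mk⇔
        (λ ret (1+c<a , top<k) →
          <-irrefl (sym (trans (diagonal {botAt c<b} ret) y≡1+c)) (<rank (proj₁ botAt-ranks) 1+c<a (<⇒≤ top<k)))
        (λ ¬below → suc c , s≤s z≤n , cong₂ _,_ (≤-antisym (x≤1+c ¬below) 1+c≤x) y≡1+c)
        where
        x≤1+c : ¬ NextTopBelow c<b → proj₁ (path T (botAt c<b)) ≤ suc c
        x≤1+c ¬below with suc c <? a
        ... | no 1+c≮a  = ≤-trans (bounded (proj₁ botAt-ranks)) (≮⇒≥ 1+c≮a)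
        ... | yes 1+c<a = rank≤ (proj₁ botAt-ranks) 1+c<a
              (≤∧≢⇒< (≮⇒≥ λ top<k → ¬below (1+c<a , top<k)) (λ k≡top → disjoint T _ _ (sym k≡top)))

mainTheorem11 : (a b : ℕ) → b ≤ a → 1 ≤ b → (T : SYT a b) →
    (c i : ℕ) → i ∈ column T c →
    (dep T c i ≡ + 1) ⇔ ReturnAt T i
mainTheorem11 a b b≤a _ T c i i∈col with ∈-column⁻ T b≤a c i∈col
... | inj₁ (c<a , refl) = mk⇔
  (λ dep≡1 → contradiction (trans (sym (dep-topAt T b≤a c c<a)) dep≡1) λ ())
  (λ ret → contradiction ret (¬ReturnAt-topAt T b≤a c c<a))
... | inj₂ (c<b , refl) =
  ⇔-sym (ReturnAt-botAt⇔ T b≤a c<b) ⇔-∘ (countLess-next≡0⇔ T b≤a c<b ⇔-∘ dep-botAt≡1⇔ T b≤a c<b)
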